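{- Let $\mathcal{G}$ be a stone-placing game played on $(B,\mathcal{F},\mathcal{S})$ which is strictly not open for both players. Suppose there is a fixed-point free involution $g$ of $B$ (a bijection $g:B\to B$ with $g(g(b))=b\neq g(b)$ for all $b$) such that for each $s\in\mathcal{S}$ there is some $f\in\mathcal{F}$ with $f\subseteq g[s]$. Then the second player in $\mathcal{G}$ does not have a winning strategy.
   Context: Stone-placing games: for a countable set $B$ and families $\mathcal{F},\mathcal{S}\subseteq\mathcal{P}(B)\setminus\{\emptyset\}$ closed under taking supersets, the stone-placing game on $(B,\mathcal{F},\mathcal{S})$ starts with all of $B$ unmarked; the two players alternately choose previously unchosen elements of $B$ (plays have length at most $\omega$); the winner is the player who first has chosen all elements of some member of his family ($\mathcal{F}$ for the first player, $\mathcal{S}$ for the second). Plays carry the topology with basic open sets $U(v)$ = plays passing through the finite position $v$. A game is strictly not open for a player if that player's set of winning plays has empty interior, i.e. contains no basic open set (the player can only win by playing infinitely many turns). -}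

module Defs where

open import Data.Nat using (ℕ; zero; suc; _*_; _<_)
open import Data.Fin using (Fin)
open import Data.Maybe using (Maybe; just; nothing)
open import Data.List using (List; map; upTo; catMaybes; length)
open import Data.List.Membership.Propositional using (_∉_)
open import Data.List.Relation.Unary.Unique.Propositional using (Unique)
open import Data.Product using (Σ; ∃; _×_)
open import Data.Sum using (_⊎_)
open import Data.Empty using (⊥)
open import Relation.Nullary using (¬_)
open import Relation.Binary.PropositionalEquality using (_≡_; _≢_)
open import Function.Bundles using (_↔_)

Countable : Set → Set
Countable B = (Σ ℕ λ n → B ↔ Fin n) ⊎ (B ↔ ℕ)

-- Parity of move indices: player I moves at even indices 0,2,4,...,
-- player II at odd indices 1,3,5,...
Even : ℕ → Set
Even n = ∃ λ k → n ≡ 2 * k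

Odd : ℕ → Set
Odd n = ∃ λ k → n ≡ suc (2 * k)

Family : Set → Set₁
Family B = (B → Set) → Set

UpClosed : {B : Set} → Family B → Set₁
UpClosed {B} 𝓕 = (x y : B → Set) → 𝓕 x → ((b : B) → x b → y b) → 𝓕 y

NoEmptyMember : {B : Set} → Family B → Set₁
NoEmptyMember {B} 𝓕 = (x : B → Set) → 𝓕 x → ¬ ((b : B) → ¬ x b)

Image : {B : Set} → (B → B) → (B → Set) → (B → Set)
Image g s b = ∃ λ b′ → s b′ × g b′ ≡ b

-- A play: π n = just b means the n-th move (0-indexed) chooses b;
-- π n = nothing means the play has ended before move n, which happens
-- only when all of B has been chosen.
IsPlay : {B : Set} → (ℕ → Maybe B) → Set
IsPlay {B} π =
  ((m n : ℕ) (b : B) → π m ≡ just b → π n ≡ just b → m ≡ n)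
  × ((n : ℕ) → π n ≡ nothing → (b : B) → ∃ λ k → k < n × π k ≡ just b)

position : {B : Set} → (ℕ → Maybe B) → ℕ → List B
position π n = catMaybes (map π (upTo n))

Extends : {B : Set} → List B → (ℕ → Maybe B) → Set
Extends v π = map just v ≡ map π (upTo (length v))

CompletedAt : {B : Set} → (ℕ → Set) → Family B → (ℕ → Maybe B) → ℕ → Set₁
CompletedAt {B} P 𝓕 π n =
  ∃ λ x → 𝓕 x × ((b : B) → x b → ∃ λ k → k < n × P k × π k ≡ just b)

CompletedEver : {B : Set} → (ℕ → Set) → Family B → (ℕ → Maybe B) → Set₁
CompletedEver {B} P 𝓕 π =
  ∃ λ x → 𝓕 x × ((b : B) → x b → ∃ λ k → P k × π k ≡ just b)

-- The player (P, 𝓕) wins π against the opponent (Q, 𝓢): he is the first to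
-- complete a member of his family, either at some finite stage n before the
-- opponent, or at stage ω while the opponent never completes.
-- (If both complete only at stage ω, neither is first: no winner.)
Wins : {B : Set} → (ℕ → Set) → Family B → (ℕ → Set) → Family B →
       (ℕ → Maybe B) → Set₁
Wins P 𝓕 Q 𝓢 π =
  (∃ λ n → CompletedAt P 𝓕 π n × ¬ CompletedAt Q 𝓢 π n)
  ⊎ (CompletedEver P 𝓕 π × ¬ CompletedEver Q 𝓢 π)

WinsI : {B : Set} → Family B → Family B → (ℕ → Maybe B) → Set₁
WinsI 𝓕 𝓢 π = Wins Even 𝓕 Odd 𝓢 π

WinsII : {B : Set} → Family B → Family B → (ℕ → Maybe B) → Set₁
WinsII 𝓕 𝓢 π = Wins Odd 𝓢 Even 𝓕 π

-- The set of winning plays W contains no basic open set U(v),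
-- v ranging over the (legal) finite positions.
EmptyInterior : {B : Set} → ((ℕ → Maybe B) → Set₁) → Set₁
EmptyInterior {B} W =
  (v : List B) → Unique v →
  ¬ ((π : ℕ → Maybe B) → IsPlay π → Extends v π → W π)

StrictlyNotOpenI : {B : Set} → Family B → Family B → Set₁
StrictlyNotOpenI 𝓕 𝓢 = EmptyInterior (WinsI 𝓕 𝓢)

StrictlyNotOpenII : {B : Set} → Family B → Family B → Set₁
StrictlyNotOpenII 𝓕 𝓢 = EmptyInterior (WinsII 𝓕 𝓢)

StrategyII : Set → Set
StrategyII B = List B → B

LegalII : {B : Set} → StrategyII B → Set
LegalII {B} σ =
  (v : List B) → Unique v → Odd (length v) → (∃ λ b → b ∉ v) → σ v ∉ v

FollowsII : {B : Set} → StrategyII B → (ℕ → Maybe B) → Set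
FollowsII {B} σ π =
  (n : ℕ) → Odd n → (b : B) → π n ≡ just b → b ≡ σ (position π n)

WinningStrategyII : {B : Set} → Family B → Family B → StrategyII B → Set₁
WinningStrategyII {B} 𝓕 𝓢 σ =
  LegalII σ ×
  ((π : ℕ → Maybe B) → IsPlay π → FollowsII σ π → WinsII 𝓕 𝓢 π)

FPFInvolution : {B : Set} → (B → B) → Set
FPFInvolution {B} g = ((b : B) → g (g b) ≡ b) × ((b : B) → g b ≢ b)

-- Player I answers every move c of player II by g c whenever g c is still
-- unchosen, and otherwise plays an arbitrary fresh element. If g c was already
-- taken, it was taken by I: had II taken it, I would already have answered
-- with g (g c) = c, so c could not be chosen again. Hence I always owns g[s]
-- for every s chosen by II. Now let II follow a winning strategy σ against
-- this mirror strategy. If II wins at a finite stage n, then every play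
-- through the position after n moves is also won by II at stage n, contrary
-- to the game being strictly not open for II. If II wins at stage ω by owning
-- some s ∈ 𝓢, then I owns g[s] ⊇ f for some f ∈ 𝓕 and has completed f too,
-- so II is not the only one to complete a member of his family.
module Submission where

open import Defs
open import Data.Empty using (⊥; ⊥-elim)
import Data.Fin.Properties as Fin
open import Data.List using (List; []; _∷_; _++_; map; upTo; applyUpTo; catMaybes; length)
open import Data.List.Extrema.Nat using (max; xs≤max)
open import Data.List.Membership.Propositional using (_∈_; _∉_)
open import Data.List.Membership.Propositional.Properties using (∈-++⁺ˡ; ∈-++⁺ʳ; ∈-++⁻; ∈-map⁺)
import Data.List.Membership.DecPropositional as DecMembership
open import Data.List.Properties
  using (catMaybes-++; map-++; applyUpTo-∷ʳ; map-upTo; length-map; length-applyUpTo; ∷-injective; ++-identityʳ)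
import Data.List.Relation.Unary.All as All
open import Data.List.Relation.Unary.AllPairs using ([]; _∷_)
open import Data.List.Relation.Unary.Any using (here)
open import Data.List.Relation.Unary.Unique.Propositional using (Unique)
open import Data.List.Relation.Unary.Unique.Propositional.Properties using (++⁺)
open import Data.Maybe using (Maybe; just; nothing)
open import Data.Maybe.Properties using (just-injective)
open import Data.Nat using (ℕ; zero; suc; _<_; _≤_; s≤s; _<?_)
open import Data.Nat.Induction using (<-wellFounded)
import Data.Nat.Properties as ℕ
open import Data.Nat.Properties
  using (*-suc; even≢odd; <-irrefl; <-cmp; <-≤-trans; <⇒≤; ≮⇒≥; n<1+n; m<n⇒m<1+n; m<1+n⇒m<n∨m≡n; 1+n≰n)
open import Data.Product using (Σ; ∃; _×_; _,_; proj₁; proj₂)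
open import Data.Sum using (_⊎_; inj₁; inj₂; [_,_]′)
open import Function using (id; _∘_)
open import Function.Bundles using (Inverse)
open import Function.Properties.Inverse using (↔⇒↣)
open import Induction.WellFounded using (Acc; acc)
open import Relation.Binary.Definitions using (DecidableEquality; tri<; tri≈; tri>)
open import Relation.Binary.PropositionalEquality
open import Relation.Nullary using (¬_; Dec; yes; no; contradiction)

even⇒suc-odd : ∀ {n} → Even n → Odd (suc n)
even⇒suc-odd (k , refl) = k , refl

odd⇒suc-even : ∀ {n} → Odd n → Even (suc n)
odd⇒suc-even (k , refl) = suc k , sym (*-suc 2 k)

even-or-odd : ∀ n → Even n ⊎ Odd n
even-or-odd zero = inj₁ (0 , refl)
even-or-odd (suc n) with even-or-odd n
... | inj₁ e = inj₂ (even⇒suc-odd e)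
... | inj₂ o = inj₁ (odd⇒suc-even o)

even⇒¬odd : ∀ {n} → Even n → ¬ Odd n
even⇒¬odd (k , refl) (j , eq) = even≢odd k j eq

applyUpTo-agree : ∀ {A : Set} {f h : ℕ → A} m → applyUpTo f m ≡ applyUpTo h m →
                  ∀ {k} → k < m → f k ≡ h k
applyUpTo-agree (suc m) eq {zero} _ = proj₁ (∷-injective eq)
applyUpTo-agree (suc m) eq {suc k} (s≤s k<m) = applyUpTo-agree m (proj₂ (∷-injective eq)) k<m

module _ {B : Set} where

  position-suc : (π : ℕ → Maybe B) (n : ℕ) →
                 position π (suc n) ≡ position π n ++ catMaybes (π n ∷ [])
  position-suc π n = begin
    catMaybes (map π (upTo (suc n)))                  ≡⟨ cong (catMaybes ∘ map π) (applyUpTo-∷ʳ id n) ⟨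
    catMaybes (map π (upTo n ++ n ∷ []))              ≡⟨ cong catMaybes (map-++ π (upTo n) (n ∷ [])) ⟩
    catMaybes (map π (upTo n) ++ π n ∷ [])            ≡⟨ catMaybes-++ (map π (upTo n)) (π n ∷ []) ⟩
    position π n ++ catMaybes (π n ∷ [])              ∎
    where open ≡-Reasoning

  position-suc-nothing : ∀ (π : ℕ → Maybe B) n → π n ≡ nothing → position π (suc n) ≡ position π n
  position-suc-nothing π n πn≡nothing rewrite position-suc π n | πn≡nothing = ++-identityʳ (position π n)

  ∈-catMaybes-singleton : ∀ {x : Maybe B} {b} → b ∈ catMaybes (x ∷ []) → x ≡ just b
  ∈-catMaybes-singleton {just _} (here refl) = refl

  ∈-position⁻ : ∀ (π : ℕ → Maybe B) {n b} → b ∈ position π n → ∃ λ k → k < n × π k ≡ just b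
  ∈-position⁻ π {suc n} b∈ with ∈-++⁻ (position π n) (subst (_ ∈_) (position-suc π n) b∈)
  ... | inj₁ b∈′ = let k , k<n , πk≡b = ∈-position⁻ π b∈′ in k , m<n⇒m<1+n k<n , πk≡b
  ... | inj₂ b∈πn = n , n<1+n n , ∈-catMaybes-singleton b∈πn

  ∈-position⁺ : ∀ (π : ℕ → Maybe B) {n k b} → k < n → π k ≡ just b → b ∈ position π n
  ∈-position⁺ π {suc n} {k} k<1+n πk≡b rewrite position-suc π n with m<1+n⇒m<n∨m≡n k<1+n
  ... | inj₁ k<n = ∈-++⁺ˡ (∈-position⁺ π k<n πk≡b)
  ... | inj₂ refl rewrite πk≡b = ∈-++⁺ʳ (position π k) (here refl)

  length-prefix : ∀ {π : ℕ → Maybe B} {xs : List B} m → map just xs ≡ map π (upTo m) → length xs ≡ m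
  length-prefix {π} {xs} m eq = begin
    length xs                ≡⟨ length-map just xs ⟨
    length (map just xs)     ≡⟨ cong length eq ⟩
    length (map π (upTo m))  ≡⟨ length-map π (upTo m) ⟩
    length (upTo m)          ≡⟨ length-applyUpTo id m ⟩
    m                        ∎
    where open ≡-Reasoning

  module _ {π : ℕ → Maybe B} (play : IsPlay π) where

    ended-persists : ∀ {m n} → π m ≡ nothing → m ≤ n → π n ≡ nothing
    ended-persists {m} {n} πm≡nothing m≤n with π n in πn≡b
    ... | nothing = refl
    ... | just b = let k , k<m , πk≡b = proj₂ play m πm≡nothing b in
                   contradiction (<-≤-trans k<m m≤n) (<-irrefl (proj₁ play k n b πk≡b πn≡b))

    ended⇒exhausted : ∀ {m n} → π m ≡ nothing → m ≤ n → ∀ b → b ∈ position π n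
    ended⇒exhausted πm≡nothing m≤n b =
      let k , k<m , πk≡b = proj₂ play _ πm≡nothing b in ∈-position⁺ π (<-≤-trans k<m m≤n) πk≡b

    unique-position : ∀ n → Unique (position π n)
    unique-position zero = []
    unique-position (suc n) rewrite position-suc π n = ++⁺ (unique-position n) (unique-singleton (π n)) disjoint
      where
      unique-singleton : ∀ x → Unique (catMaybes (x ∷ []))
      unique-singleton (just _) = All.[] ∷ []
      unique-singleton nothing = []
      disjoint : ∀ {b} → ¬ (b ∈ position π n × b ∈ catMaybes (π n ∷ []))
      disjoint {b} (b∈ , b∈πn) = let k , k<n , πk≡b = ∈-position⁻ π b∈ in
        <-irrefl (proj₁ play k n b πk≡b (∈-catMaybes-singleton b∈πn)) k<n

    -- m is n, or the stage at which the play ended if that is earlier.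
    position-prefix : ∀ n → ∃ λ m → (m ≡ n ⊎ (m < n × π m ≡ nothing)) ×
                                    map just (position π n) ≡ map π (upTo m)
    position-prefix zero = 0 , inj₁ refl , refl
    position-prefix (suc n) with position-prefix n
    ... | m , inj₂ (m<n , πm≡nothing) , prefix =
          m , inj₂ (m<n⇒m<1+n m<n , πm≡nothing) ,
          trans (cong (map just) (position-suc-nothing π n (ended-persists πm≡nothing (<⇒≤ m<n)))) prefix
    ... | .n , inj₁ refl , prefix with π n in πn≡b
    ...   | nothing = n , inj₂ (n<1+n n , πn≡b) , trans (cong (map just) (position-suc-nothing π n πn≡b)) prefix
    ...   | just b = suc n , inj₁ refl , (begin
      map just (position π (suc n))               ≡⟨ cong (map just) (position-suc π n) ⟩
      map just (position π n ++ catMaybes (π n ∷ [])) ≡⟨ cong (λ x → map just (position π n ++ catMaybes (x ∷ []))) πn≡b ⟩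
      map just (position π n ++ b ∷ [])           ≡⟨ map-++ just (position π n) (b ∷ []) ⟩
      map just (position π n) ++ just b ∷ []      ≡⟨ cong₂ (λ xs x → xs ++ x ∷ []) prefix (sym πn≡b) ⟩
      map π (upTo n) ++ π n ∷ []                  ≡⟨ map-++ π (upTo n) (n ∷ []) ⟨
      map π (upTo n ++ n ∷ [])                    ≡⟨ cong (map π) (applyUpTo-∷ʳ id n) ⟩
      map π (upTo (suc n))                        ∎)
      where open ≡-Reasoning

    length-position : ∀ n → (∃ λ b → b ∉ position π n) → length (position π n) ≡ n
    length-position n (b , b∉) with position-prefix n
    ... | .n , inj₁ refl , prefix = length-prefix n prefix
    ... | m , inj₂ (m<n , πm≡nothing) , _ = contradiction (ended⇒exhausted πm≡nothing (<⇒≤ m<n) b) b∉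

  extends-prefix⇒agree : ∀ {π π′ : ℕ → Maybe B} {n} m → Extends (position π n) π′ →
                        map just (position π n) ≡ map π (upTo m) → ∀ {k} → k < m → π′ k ≡ π k
  extends-prefix⇒agree {π} {π′} {n} m ext prefix = applyUpTo-agree m (begin
    applyUpTo π′ m                          ≡⟨ map-upTo π′ m ⟨
    map π′ (upTo m)                         ≡⟨ cong (map π′ ∘ upTo) (length-prefix m prefix) ⟨
    map π′ (upTo (length (position π n)))   ≡⟨ ext ⟨
    map just (position π n)                 ≡⟨ prefix ⟩
    map π (upTo m)                          ≡⟨ map-upTo π m ⟩
    applyUpTo π m                           ∎)
    where open ≡-Reasoning

  -- π′ cannot choose anything at k ≥ m: every element was already chosen
  -- by π, hence by π′, before m.
  agree-after-end : ∀ {π π′ : ℕ → Maybe B} {m k} → IsPlay π → IsPlay π′ →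
                    (∀ {j} → j < m → π′ j ≡ π j) → π m ≡ nothing → m ≤ k → π′ k ≡ π k
  agree-after-end {π} {π′} {m} {k} play play′ agree πm≡nothing m≤k
    rewrite ended-persists play πm≡nothing m≤k with π′ k in π′k≡b
  ... | nothing = refl
  ... | just b = let j , j<m , πj≡b = proj₂ play m πm≡nothing b in
                 contradiction (<-≤-trans j<m m≤k)
                   (<-irrefl (proj₁ play′ j k b (trans (agree j<m) πj≡b) π′k≡b))

  extends-position⇒agree : ∀ {π π′ : ℕ → Maybe B} → IsPlay π → IsPlay π′ →
                           ∀ n → Extends (position π n) π′ → ∀ {k} → k < n → π′ k ≡ π k
  extends-position⇒agree {π} {π′} play play′ n ext {k} k<n with position-prefix play n
  ... | .n , inj₁ refl , prefix = extends-prefix⇒agree {π} {π′} {n} n ext prefix k<n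
  ... | m , inj₂ (_ , πm≡nothing) , prefix with k <? m
  ...   | yes k<m = extends-prefix⇒agree {π} {π′} {n} m ext prefix k<m
  ...   | no k≮m =
    agree-after-end play play′ (extends-prefix⇒agree {π} {π′} {n} m ext prefix) πm≡nothing (≮⇒≥ k≮m)

  CompletedAt-agree : ∀ {P : ℕ → Set} {𝓐 : Family B} {π π′ : ℕ → Maybe B} {n} →
                      (∀ {k} → k < n → π k ≡ π′ k) → CompletedAt P 𝓐 π n → CompletedAt P 𝓐 π′ n
  CompletedAt-agree agree (x , x∈𝓐 , chosen) = x , x∈𝓐 , λ b xb →
    let k , k<n , Pk , πk≡b = chosen b xb in k , k<n , Pk , trans (sym (agree k<n)) πk≡b

  Wins-at-stage-open : ∀ {P Q : ℕ → Set} {𝓐 𝓑 : Family B} {π : ℕ → Maybe B} {n} → IsPlay π →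
                       CompletedAt P 𝓐 π n → ¬ CompletedAt Q 𝓑 π n →
                       ∀ π′ → IsPlay π′ → Extends (position π n) π′ → Wins P 𝓐 Q 𝓑 π′
  Wins-at-stage-open {π = π} {n} play done not-done π′ play′ ext =
    inj₁ (n , CompletedAt-agree (sym ∘ agree) done , not-done ∘ CompletedAt-agree agree)
    where
    agree : ∀ {k} → k < n → π′ k ≡ π k
    agree = extends-position⇒agree play play′ n ext

ValidMove : {B : Set} → List B → Maybe B → Set
ValidMove v (just b) = b ∉ v
ValidMove {B} v nothing = (b : B) → b ∈ v

module Run {B : Set} (next : ℕ → List B → Maybe B → Maybe B) where

  mutual
    chosen : ℕ → List B
    chosen zero = []
    chosen (suc n) = chosen n ++ catMaybes (move n ∷ [])

    move : ℕ → Maybe B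
    move zero = next zero [] nothing
    move (suc n) = next (suc n) (chosen (suc n)) (move n)

  position-move : ∀ n → position move n ≡ chosen n
  position-move zero = refl
  position-move (suc n) = trans (position-suc move n) (cong (_++ catMaybes (move n ∷ [])) (position-move n))

  module _ (next-valid : ∀ n v p → ValidMove v (next n v p)) where

    move-valid : ∀ n → ValidMove (chosen n) (move n)
    move-valid zero = next-valid zero [] nothing
    move-valid (suc n) = next-valid (suc n) (chosen (suc n)) (move n)

    move-isPlay : IsPlay move
    move-isPlay = injective , exhausted
      where
      not-rechosen : ∀ {m n b} → m < n → move m ≡ just b → move n ≡ just b → ⊥
      not-rechosen {m} {n} m<n mm≡b mn≡b =
        subst (ValidMove (chosen n)) mn≡b (move-valid n) (subst (_ ∈_) (position-move n) (∈-position⁺ move m<n mm≡b))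
      injective : ∀ m n b → move m ≡ just b → move n ≡ just b → m ≡ n
      injective m n b mm≡b mn≡b with <-cmp m n
      ... | tri< m<n _ _ = ⊥-elim (not-rechosen m<n mm≡b mn≡b)
      ... | tri≈ _ m≡n _ = m≡n
      ... | tri> _ _ n<m = ⊥-elim (not-rechosen n<m mn≡b mm≡b)
      exhausted : ∀ n → move n ≡ nothing → ∀ b → ∃ λ k → k < n × move k ≡ just b
      exhausted n mn≡nothing b = ∈-position⁻ move (subst (b ∈_) (sym (position-move n))
                                   (subst (ValidMove (chosen n)) mn≡nothing (move-valid n) b))

FreshChoice : Set → Set
FreshChoice B = (v : List B) → (∃ λ b → b ∉ v) ⊎ ((b : B) → b ∈ v)

countable⇒≟ : {B : Set} → Countable B → DecidableEquality B
countable⇒≟ (inj₁ (_ , B↔Fin)) = Fin.inj⇒≟ (↔⇒↣ B↔Fin)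
countable⇒≟ (inj₂ B↔ℕ) = ℕ.eq? (↔⇒↣ B↔ℕ)

countable⇒freshChoice : {B : Set} → (countable : Countable B) → FreshChoice B
countable⇒freshChoice countable@(inj₁ (n , B↔Fin)) v = decide (Fin.all? (λ i → from i ∈? v))
  where
  open Inverse B↔Fin
  open DecMembership (countable⇒≟ countable) using (_∈?_)
  decide : Dec (∀ i → from i ∈ v) → (∃ λ b → b ∉ v) ⊎ (∀ b → b ∈ v)
  decide (yes all∈) = inj₂ (λ b → subst (_∈ v) (strictlyInverseʳ b) (all∈ (to b)))
  decide (no ¬all∈) = let i , i∉ = Fin.¬∀⟶∃¬ n _ (λ i → from i ∈? v) ¬all∈ in inj₁ (from i , i∉)
countable⇒freshChoice (inj₂ B↔ℕ) v = inj₁ (from (suc bound) , beyond-bound)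
  where
  open Inverse B↔ℕ
  bound : ℕ
  bound = max 0 (map to v)
  beyond-bound : from (suc bound) ∉ v
  beyond-bound b∈ = 1+n≰n (subst (_≤ bound) (strictlyInverseˡ (suc bound))
                             (All.lookup (xs≤max 0 (map to v)) (∈-map⁺ to b∈)))

module MirrorPlay {B : Set} (_≟_ : DecidableEquality B) (fresh : FreshChoice B)
                  (g : B → B) (σ : StrategyII B) where
  open DecMembership _≟_ using (_∈?_)

  freshMove : List B → Maybe B
  freshMove v with fresh v
  ... | inj₁ (b , _) = just b
  ... | inj₂ _ = nothing

  mirrorMove : List B → Maybe B → Maybe B
  mirrorMove v (just c) with g c ∈? v
  ... | no _ = just (g c)
  ... | yes _ = freshMove v
  mirrorMove v nothing = freshMove v

  -- σ's move, replaced by a fresh one where it is illegal, so that the play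
  -- is defined whether or not σ is legal.
  σMove : List B → Maybe B
  σMove v with fresh v | σ v ∈? v
  ... | inj₂ _ | _ = nothing
  ... | inj₁ _ | no _ = just (σ v)
  ... | inj₁ (b , _) | yes _ = just b

  next : ℕ → List B → Maybe B → Maybe B
  next n v p = [ (λ _ → mirrorMove v p) , (λ _ → σMove v) ]′ (even-or-odd n)

  freshMove-valid : ∀ v → ValidMove v (freshMove v)
  freshMove-valid v with fresh v
  ... | inj₁ (_ , b∉) = b∉
  ... | inj₂ exhausted = exhausted

  mirrorMove-valid : ∀ v p → ValidMove v (mirrorMove v p)
  mirrorMove-valid v (just c) with g c ∈? v
  ... | no gc∉ = gc∉
  ... | yes _ = freshMove-valid v
  mirrorMove-valid v nothing = freshMove-valid v

  σMove-valid : ∀ v → ValidMove v (σMove v)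
  σMove-valid v with fresh v | σ v ∈? v
  ... | inj₂ exhausted | _ = exhausted
  ... | inj₁ _ | no σv∉ = σv∉
  ... | inj₁ (_ , b∉) | yes _ = b∉

  next-valid : ∀ n v p → ValidMove v (next n v p)
  next-valid n v p with even-or-odd n
  ... | inj₁ _ = mirrorMove-valid v p
  ... | inj₂ _ = σMove-valid v

  open Run next public using (chosen; move; position-move)

  isPlay : IsPlay move
  isPlay = Run.move-isPlay next next-valid

  next-even : ∀ {n v p} → Even n → next n v p ≡ mirrorMove v p
  next-even {n} e with even-or-odd n
  ... | inj₁ _ = refl
  ... | inj₂ o = contradiction o (even⇒¬odd e)

  move-odd : ∀ {n} → Odd n → move n ≡ σMove (chosen n)
  move-odd {zero} (_ , ())
  move-odd {suc n} o with even-or-odd (suc n)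
  ... | inj₁ e = contradiction o (even⇒¬odd e)
  ... | inj₂ _ = refl

  σMove-follows : ∀ v {b} → ((∃ λ c → c ∉ v) → σ v ∉ v) → σMove v ≡ just b → b ≡ σ v
  σMove-follows v legal eq with fresh v | σ v ∈? v
  σMove-follows v legal () | inj₂ _ | _
  ... | inj₁ _ | no _ = sym (just-injective eq)
  ... | inj₁ c∉ | yes σv∈ = contradiction σv∈ (legal c∉)

  unique-chosen : ∀ n → Unique (chosen n)
  unique-chosen n = subst Unique (position-move n) (unique-position isPlay n)

  length-chosen : ∀ n → (∃ λ c → c ∉ chosen n) → length (chosen n) ≡ n
  length-chosen n rewrite sym (position-move n) = length-position isPlay n

  follows-σ : LegalII σ → FollowsII σ move
  follows-σ legal n odd b mn≡b = subst (λ v → b ≡ σ v) (sym (position-move n))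
    (σMove-follows (chosen n) legal-here (trans (sym (move-odd odd)) mn≡b))
    where
    legal-here : (∃ λ c → c ∉ chosen n) → σ (chosen n) ∉ chosen n
    legal-here fresh-c = legal (chosen n) (unique-chosen n) (subst Odd (sym (length-chosen n fresh-c)) odd) fresh-c

  module _ (g-involutive : ∀ b → g (g b) ≡ b) (g-fixpoint-free : ∀ b → g b ≢ b) where

    mirror-answers : ∀ {k c} → Odd k → move k ≡ just c → ∃ λ j → Even j × move j ≡ just (g c)
    mirror-answers = answered (<-wellFounded _)
      where
      answered : ∀ {k c} → Acc _<_ k → Odd k → move k ≡ just c → ∃ λ j → Even j × move j ≡ just (g c)
      answered {k} {c} (acc earlier) k-odd mk≡c with g c ∈? chosen (suc k)
      ... | no gc∉ = suc k , odd⇒suc-even k-odd , (begin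
        next (suc k) (chosen (suc k)) (move k)   ≡⟨ next-even {p = move k} (odd⇒suc-even k-odd) ⟩
        mirrorMove (chosen (suc k)) (move k)     ≡⟨ cong (mirrorMove (chosen (suc k))) mk≡c ⟩
        mirrorMove (chosen (suc k)) (just c)     ≡⟨ mirror-fresh gc∉ ⟩
        just (g c)                               ∎)
        where
        open ≡-Reasoning
        mirror-fresh : ∀ {v} → g c ∉ v → mirrorMove v (just c) ≡ just (g c)
        mirror-fresh {v} gc∉v with g c ∈? v
        ... | no _ = refl
        ... | yes gc∈v = contradiction gc∈v gc∉v
      ... | yes gc∈ with ∈-position⁻ move (subst (g c ∈_) (sym (position-move (suc k))) gc∈)
      ...   | j , j<1+k , mj≡gc with even-or-odd j
      ...     | inj₁ j-even = j , j-even , mj≡gc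
      ...     | inj₂ j-odd with m<1+n⇒m<n∨m≡n j<1+k
      ...       | inj₂ refl = contradiction (just-injective (trans (sym mj≡gc) mk≡c)) (g-fixpoint-free c)
      ...       | inj₁ j<k with answered (earlier j<k) j-odd mj≡gc
      ...         | j′ , j′-even , mj′≡ggc =
        contradiction k-odd (even⇒¬odd (subst Even
          (proj₁ isPlay j′ k c (trans mj′≡ggc (cong just (g-involutive c))) mk≡c) j′-even))

    II-completes⇒I-completes : ∀ {𝓕 𝓢 : Family B} →
      ((s : B → Set) → 𝓢 s → ∃ λ f → 𝓕 f × ((b : B) → f b → Image g s b)) →
      CompletedEver Odd 𝓢 move → CompletedEver Even 𝓕 move
    II-completes⇒I-completes image-contains (s , s∈𝓢 , II-chose) =
      let f , f∈𝓕 , f⊆g[s] = image-contains s s∈𝓢 in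
      f , f∈𝓕 , λ b fb →
        let b′ , sb′ , gb′≡b = f⊆g[s] b fb
            k , k-odd , mk≡b′ = II-chose b′ sb′
            j , j-even , mj≡gb′ = mirror-answers k-odd mk≡b′
        in j , j-even , trans mj≡gb′ (cong just gb′≡b)

propositionA3 : (B : Set) → Countable B →
    (𝓕 𝓢 : Family B) →
    UpClosed 𝓕 → UpClosed 𝓢 → NoEmptyMember 𝓕 → NoEmptyMember 𝓢 →
    StrictlyNotOpenI 𝓕 𝓢 → StrictlyNotOpenII 𝓕 𝓢 →
    (g : B → B) → FPFInvolution g →
    ((s : B → Set) → 𝓢 s → ∃ λ f → 𝓕 f × ((b : B) → f b → Image g s b)) →
    ¬ (Σ (StrategyII B) λ σ → WinningStrategyII 𝓕 𝓢 σ)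
propositionA3 B countable 𝓕 𝓢 _ _ _ _ _ not-open-II g (g-involutive , g-fixpoint-free) image-contains
  (σ , legal , σ-wins) = II-loses-mirror-play (σ-wins move isPlay (follows-σ legal))
  where
  open MirrorPlay (countable⇒≟ countable) (countable⇒freshChoice countable) g σ
  II-loses-mirror-play : ¬ WinsII 𝓕 𝓢 move
  II-loses-mirror-play (inj₁ (n , II-done , I-not-done)) =
    not-open-II (position move n) (unique-position isPlay n) (Wins-at-stage-open {n = n} isPlay II-done I-not-done)
  II-loses-mirror-play (inj₂ (II-done , I-never)) =
    I-never (II-completes⇒I-completes g-involutive g-fixpoint-free image-contains II-done)
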